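{- Let $\Sigma=(G,\sigma)$ be a connected signed (simple) graph and let $U=\{u_1,\ldots,u_k\}$ be an independent set of vertices of $G$. Then for any embedding of $\Sigma$ given by a rotation system $R$ (with the edges of $\partial(U)$ untwisted), the interior permutation satisfies $Int_{R,U}=R^1R^2\cdots R^k$, where $R^i$ is the (counter-clockwise) rotation of the edges incident with $u_i$, $i=1,\ldots,k$.
   Context: A signed graph $\Sigma=(G,\sigma)$ is a graph $G$ with $\sigma:E(G)\to\{+1,-1\}$; an embedding of $\Sigma$ is given by a signed rotation system $(R,\sigma)$, where $R$ is a rotation system of $G$ (cyclic ordering of edge-ends at each vertex, taken counter-clockwise) and $\sigma$ serves as twist indicator. $\partial(U)$ is the set of edges oriented from a vertex of $U$ to a vertex of $V(G)\setminus U$. The interior permutation $Int_{R,U}$ of $\partial(U)$ is defined (when $\sigma(e)=1$ for all $e\in\partial(U)$) as follows: for $e\in\partial(U)$, start from the left side of $e$ and follow the boundary of the face of the embedding containing it until the first edge $e_t\in\partial(U)$ is encountered (on its right side); then $Int_{R,U}(e)=e_t$. Formally, with each edge split into four symbols $e^{l_\pm},e^{r_\pm}$, $\alpha$ swapping sides at the same end, $\beta$ swapping ends on the same side, $\gamma=\alpha\beta$ and $P$ the bi-rotation of the embedding, $Int_{R,U}(e)=\gamma[\gamma P]^{y(e)}(e^{l_\delta})$ with $y(e)$ the least positive integer such that $[\gamma P]^{y(e)}(e^{l_\delta})\in\{e_t^{r_+},e_t^{r_- }\}$ for some $e_t\in\partial(U)$. Each $R^i$ is viewed as a cyclic permutation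 of the edges of $\partial(U)$ incident with $u_i$. -}

module Defs where

open import Data.Nat using (ℕ; zero; suc; _<_; _≤_)
open import Data.Fin using (Fin; _≟_)
open import Data.Product using (Σ; ∃; _×_; _,_; proj₁; proj₂)
open import Data.Sum using (_⊎_)
open import Data.Sign using (Sign) renaming (+ to plus; - to minus)
open import Data.List using (List; foldr)
open import Data.List using () renaming (allFin to allFinL)
open import Function using (_∘_; id)
open import Function.Definitions using (Injective)
open import Relation.Nullary using (¬_; yes; no)
open import Relation.Binary.PropositionalEquality using (_≡_; _≢_)

-- Signed simple graphs.  Vertices Fin n, edges Fin m; every edge carries
-- a reference orientation tl e → hd e (needed for "left/right side" and
-- for ∂(U)), and a sign σ e.

record SignedGraph : Set where
  field
    n : ℕ
    m : ℕ
    tl : Fin m → Fin n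
    hd : Fin m → Fin n
    σ  : Fin m → Sign
    noLoop : ∀ e → tl e ≢ hd e
    noParallel : ∀ e f →
      ((tl e ≡ tl f × hd e ≡ hd f) ⊎ (tl e ≡ hd f × hd e ≡ tl f)) → e ≡ f

module _ (G : SignedGraph) where
  open SignedGraph G

  data Reach : Fin n → Fin n → Set where
    here : ∀ {v} → Reach v v
    fwd  : ∀ {v} e → Reach (hd e) v → Reach (tl e) v
    bwd  : ∀ {v} e → Reach (tl e) v → Reach (hd e) v

  Connected : Set
  Connected = ∀ v w → Reach v w

  data End : Set where
    tailEnd headEnd : End

  Dart : Set
  Dart = Fin m × End

  vertexOf : Dart → Fin n
  vertexOf (e , tailEnd) = tl e
  vertexOf (e , headEnd) = hd e

  otherEnd : End → End
  otherEnd tailEnd = headEnd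
  otherEnd headEnd = tailEnd

  iter : {A : Set} → (A → A) → ℕ → A → A
  iter f zero    x = x
  iter f (suc k) x = f (iter f k x)

  -- A rotation system: a permutation ρ of the darts which maps each dart
  -- to the next dart (counter-clockwise) at the same vertex and whose
  -- restriction to the darts at any vertex is a single cycle.
  record RotationSystem : Set where
    field
      ρ    : Dart → Dart
      ρ⁻¹  : Dart → Dart
      ρ∘ρ⁻¹ : ∀ d → ρ (ρ⁻¹ d) ≡ d
      ρ⁻¹∘ρ : ∀ d → ρ⁻¹ (ρ d) ≡ d
      ρ-local : ∀ d → vertexOf (ρ d) ≡ vertexOf d
      ρ-cyclic : ∀ d d' → vertexOf d ≡ vertexOf d' → ∃ λ k → iter ρ k d ≡ d'

  -- Flags: a dart together with a side, the side being taken relative to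
  -- the direction pointing OUT of the vertex along the dart.
  -- L = the side facing the next dart counter-clockwise, R = the other one.

  data Side : Set where
    L R : Side

  flipSide : Side → Side
  flipSide L = R
  flipSide R = L

  Flag : Set
  Flag = Dart × Side

  module Faces (Rot : RotationSystem) where
    open RotationSystem Rot

    corner : Flag → Flag
    corner (d , L) = (ρ d , R)
    corner (d , R) = (ρ⁻¹ d , L)

    -- travelling along an edge to its other end; the side relative to
    -- the outward direction flips for an untwisted edge and is kept for a
    -- twisted edge (σ is the twist indicator)
    crossSide : Sign → Side → Side
    crossSide plus  s = flipSide s
    crossSide minus s = s

    cross : Flag → Flag
    cross ((e , x) , s) = ((e , otherEnd x) , crossSide (σ e) s)

    step : Flag → Flag
    step = cross ∘ corner

    -- the flag lies on the LEFT side of e w.r.t. e's orientation tl e → hd e,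
    -- at the tail end (the symbol we start from)
    leftTailFlag : Fin m → Flag
    leftTailFlag e = ((e , tailEnd) , L)

    -- the flag lies on the RIGHT side of e w.r.t. e's orientation
    -- (either end): e^{r_+} or e^{r_-}
    RightFlagOf : Fin m → Flag → Set
    RightFlagOf e x = (x ≡ ((e , tailEnd) , R)) ⊎ (x ≡ ((e , headEnd) , L))

  module WithU {k : ℕ} (u : Fin k → Fin n) where

    InU : Fin n → Set
    InU v = ∃ λ i → v ≡ u i

    Independent : Set
    Independent = ∀ e → ¬ (InU (tl e) × InU (hd e))

    InBoundary : Fin m → Set
    InBoundary e = InU (tl e) × ¬ InU (hd e)

    OrientedOutOfU : Set
    OrientedOutOfU = ∀ e → ¬ InU (hd e)

    BoundaryUntwisted : Set
    BoundaryUntwisted = ∀ e → InBoundary e → σ e ≡ plus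

    module IntPerm (Rot : RotationSystem) where
      open RotationSystem Rot
      open Faces Rot

      IntIs : Fin m → Fin m → Set
      IntIs e e' = Σ ℕ λ y → (1 ≤ y) × InBoundary e' ×
                     RightFlagOf e' (iter step y (leftTailFlag e)) ×
                     (∀ y' → 1 ≤ y' → y' < y → ∀ f → InBoundary f →
                        ¬ RightFlagOf f (iter step y' (leftTailFlag e)))

      Rot-i : Fin k → Fin m → Fin m
      Rot-i i e with tl e ≟ u i
      ... | yes _ = proj₁ (ρ (e , tailEnd))
      ... | no  _ = e

      -- R^1 R^2 ⋯ R^k as composition of maps (R^k applied first)
      Rprod : Fin m → Fin m
      Rprod = foldr (λ i g → Rot-i i ∘ g) id (allFinL k)

{-# OPTIONS --safe #-}
-- Because every edge at U points out of U, the dart following an edge e of ∂(U)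
-- counter-clockwise at its tail u_i is again the tail of an edge f ∈ ∂(U).  The face
-- walk that leaves the left side of e turns the corner at u_i and runs along f on its
-- right side, so it meets ∂(U) after a single step and Int(e) = f = R^i(e).  The other
-- rotations R^j (j ≠ i) fix every edge at u_i, hence R^1 ⋯ R^k acts on e as R^i.
module Submission where

open import Defs
open import Data.Nat using (ℕ; s≤s; z≤n)
open import Data.Fin using (Fin; _≟_)
open import Data.Product using (∃; _×_; _,_; proj₁)
open import Data.Sum using (inj₂)
open import Data.Sign using () renaming (+ to plus)
open import Data.Empty using (⊥-elim)
open import Data.List using (List; []; _∷_; foldr; allFin)
open import Data.List.Relation.Unary.All using (lookup)
open import Data.List.Relation.Unary.Any using (here; there)
open import Data.List.Membership.Propositional using (_∈_)
open import Data.List.Membership.Propositional.Properties using (∈-allFin)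
open import Data.List.Relation.Unary.Unique.Propositional using (Unique)
open import Data.List.Relation.Unary.Unique.Propositional.Properties using (allFin⁺)
open import Data.List.Relation.Unary.AllPairs using (_∷_)
open import Function using (_∘_; id)
open import Function.Definitions using (Injective)
open import Relation.Nullary using (yes; no)
open import Relation.Binary.PropositionalEquality using (_≡_; _≢_; refl; sym; trans; cong; subst)

module Composition {I A : Set} (f : I → A → A) where

  compose : List I → A → A
  compose = foldr (λ i g → f i ∘ g) id

  compose-fixed : ∀ l x → (∀ {j} → j ∈ l → f j x ≡ x) → compose l x ≡ x
  compose-fixed []      x fixed = refl
  compose-fixed (j ∷ l) x fixed =
    trans (cong (f j) (compose-fixed l x (fixed ∘ there))) (fixed (here refl))

  compose-single : (P : A → Set) (i : I) →
    (∀ y → P y → P (f i y)) → (∀ j → j ≢ i → ∀ y → P y → f j y ≡ y) →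
    ∀ {l} → i ∈ l → Unique l → ∀ x → P x → compose l x ≡ f i x
  compose-single P i preserves fixes (here refl) (i∉l ∷ _) x Px =
    cong (f i) (compose-fixed _ x λ j∈l → fixes _ (λ { refl → lookup i∉l j∈l refl }) x Px)
  compose-single P i preserves fixes {j ∷ _} (there i∈l) (j∉l ∷ uniq) x Px =
    trans (cong (f j) (compose-single P i preserves fixes i∈l uniq x Px))
          (fixes j (λ { refl → lookup j∉l i∈l refl }) (f i x) (preserves x Px))

module _ (G : SignedGraph) {k : ℕ} (u : Fin k → Fin (SignedGraph.n G))
         (Rot : RotationSystem G) where
  open SignedGraph G
  open RotationSystem Rot
  open Faces G Rot
  open WithU G u
  open IntPerm Rot

  next-outgoing : OrientedOutOfU → ∀ {i} x → tl x ≡ u i →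
    ∃ λ f → ρ (x , tailEnd) ≡ (f , tailEnd) × tl f ≡ u i
  next-outgoing out x tlx with ρ (x , tailEnd) | ρ-local (x , tailEnd)
  ... | f , tailEnd | same = f , refl , trans same tlx
  ... | f , headEnd | same = ⊥-elim (out f (_ , trans same tlx))

  Rot-i-rotates : ∀ i x → tl x ≡ u i → Rot-i i x ≡ proj₁ (ρ (x , tailEnd))
  Rot-i-rotates i x tlx with tl x ≟ u i
  ... | yes _ = refl
  ... | no tlx≢ = ⊥-elim (tlx≢ tlx)

  Rot-i-fixes : ∀ j x → tl x ≢ u j → Rot-i j x ≡ x
  Rot-i-fixes j x tlx≢ with tl x ≟ u j
  ... | yes tlx = ⊥-elim (tlx≢ tlx)
  ... | no _ = refl

  Rot-i-preserves : OrientedOutOfU → ∀ i x → tl x ≡ u i → tl (Rot-i i x) ≡ u i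
  Rot-i-preserves out i x tlx with next-outgoing out x tlx
  ... | f , next , tlf = trans (cong tl (trans (Rot-i-rotates i x tlx) (cong proj₁ next))) tlf

  Rprod-rotates : Injective _≡_ _≡_ u → OrientedOutOfU →
    ∀ i x → tl x ≡ u i → Rprod x ≡ proj₁ (ρ (x , tailEnd))
  Rprod-rotates inj out i x tlx =
    trans (Composition.compose-single Rot-i (λ y → tl y ≡ u i) i
             (Rot-i-preserves out i) fixes (∈-allFin i) (allFin⁺ k) x tlx)
          (Rot-i-rotates i x tlx)
    where
    fixes : ∀ j → j ≢ i → ∀ y → tl y ≡ u i → Rot-i j y ≡ y
    fixes j j≢i y tly = Rot-i-fixes j y λ tly′ → j≢i (inj (trans (sym tly′) tly))

  IntIs-next : ∀ e f → ρ (e , tailEnd) ≡ (f , tailEnd) → InBoundary f → σ f ≡ plus →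
    IntIs e f
  IntIs-next e f next ∂f σf = 1 , s≤s z≤n , ∂f , right , λ { _ (s≤s z≤n) (s≤s ()) }
    where
    right : RightFlagOf f (step (leftTailFlag e))
    right rewrite next | σf = inj₂ refl

mainTheorem2 : (G : SignedGraph) → Connected G →
    {k : ℕ} (u : Fin k → Fin (SignedGraph.n G)) → Injective _≡_ _≡_ u →
    WithU.Independent G u → WithU.OrientedOutOfU G u →
    (Rot : RotationSystem G) → WithU.BoundaryUntwisted G u →
    ∀ e → WithU.InBoundary G u e →
      WithU.IntPerm.IntIs G u Rot e (WithU.IntPerm.Rprod G u Rot e)
mainTheorem2 G _ u inj _ out Rot untwisted e ((i , tle) , _)
  with next-outgoing G u Rot out e tle
... | f , next , tlf =
  subst (WithU.IntPerm.IntIs G u Rot e) (sym Rprod-e≡f) (IntIs-next G u Rot e f next ∂f (untwisted f ∂f))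
  where
  ∂f : WithU.InBoundary G u f
  ∂f = (i , tlf) , out f
  Rprod-e≡f : WithU.IntPerm.Rprod G u Rot e ≡ f
  Rprod-e≡f = trans (Rprod-rotates G u Rot inj out i e tle) (cong proj₁ next)
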